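{- Let $\langle A,\vee\rangle$ be a join-semilattice with a greatest element $1$, and let $I_1,I_2$ be subsemilattices of $A$. Then $A=I_1\oplus_1 I_2$ if and only if: (exi') $I_1\vee I_2=\{1\}$, i.e. $x_1\vee x_2=1$ for all $x_1\in I_1$, $x_2\in I_2$; (onto') $I_1\wedge I_2=A$, i.e. for all $x_1\in I_1$, $x_2\in I_2$ the infimum $x_1\wedge x_2$ exists, and every element of $A$ is of the form $x_1\wedge x_2$ with $x_1\in I_1$, $x_2\in I_2$; (Mod1') for all $x_1\in I_1$, $x_2\in I_2$ and all $y\in A$, $(x_1\wedge x_2)\vee y=(y\vee x_1)\wedge(y\vee x_2)$. Moreover, if $A=I_1\oplus_1 I_2$, then $I_1$ and $I_2$ are dual ideals of $A$ (upward closed sets).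
   Context: A join-semilattice $\langle A,\vee\rangle$ is a set with an idempotent, commutative, associative binary operation $\vee$, ordered by $a\le b$ iff $a\vee b=b$. The partial operation $a\wedge b$ denotes the infimum of $\{a,b\}$ when it exists. Convention: any equation $t_1=t_2$ involving $\wedge$ means "if either side exists, then the other also exists and they are equal". A subsemilattice is a subset closed under $\vee$. For fixed $c\in A$, $\phi_c(x_1,x_2,x)$ is the conjunction of: (dist) $x=(x\vee x_1)\wedge(x\vee x_2)$; (p1) $x_1=(x\vee x_1)\wedge(c\vee x_1)$; (p2) $x_2=(x\vee x_2)\wedge(c\vee x_2)$; (join) $x_1\vee x_2=x\vee c$. For subsemilattices $I_1,I_2$, $A=I_1\oplus_c I_2$ means all of the following hold: (Mod1) for all $x,y\in A$, $x_1\in I_1$, $x_2\in I_2$: if $x\vee c\ge x_1\vee x_2$ then $((x\vee x_1)\wedge(x\vee x_2))\vee y=(x\vee y\vee x_1)\wedge(x\vee y\vee x_2)$; (Mod2) for all $x,y\in A$, $x_1\in I_1$, $x_2\in I_2$: if $x\le x_1\vee x_2$ then $((x\vee x_i)\wedge(c\vee x_i))\vee y=(x\vee y\vee x_i)\wedge(c\vee y\vee x_i)$ for $i=1,2$; (Abs) for all $x_1,y_1\in I_1$, $z_2\in I_2$: $x_1\wedge(y_1\vee z_2)=x_1\wedge(y_1\vee c)$, and likewise with $I_1,I_2$ interchanged; (exi) for all $x_1\in I_1,x_2\in I_2$ there is $x\in A$ with $\phi_c(x_1,x_2,x)$; (onto) for all $x\in A$ there are $x_1\in I_1,x_2\in I_2$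 with $\phi_c(x_1,x_2,x)$. Here $A=I_1\oplus_1 I_2$ is this notion with $c=1$. -}

module Defs where

open import Level using (Level; suc; _⊔_)
open import Data.Product using (Σ; ∃; _×_; _,_)
open import Relation.Binary.PropositionalEquality using (_≡_)
open import Relation.Unary using (Pred)
open import Algebra.Core using (Op₂)
open import Algebra.Lattice.Structures using (IsSemilattice)

record JoinSemilattice (a : Level) : Set (suc a) where
  infixl 6 _∨_
  field
    Carrier       : Set a
    _∨_           : Op₂ Carrier
    isSemilattice : IsSemilattice _≡_ _∨_

module _ {a : Level} (L : JoinSemilattice a) where
  open JoinSemilattice L

  _≤_ : Carrier → Carrier → Set a
  x ≤ y = x ∨ y ≡ y

  IsInf : Carrier → Carrier → Carrier → Set a
  IsInf x y m = m ≤ x × m ≤ y × (∀ z → z ≤ x → z ≤ y → z ≤ m)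

  -- Partially defined terms: a term t is represented by the predicate
  -- "t is defined and has value v".
  PTerm : Set (suc a)
  PTerm = Carrier → Set a

  ⌜_⌝ : Carrier → PTerm
  ⌜ x ⌝ v = x ≡ v

  _⊓_ : PTerm → PTerm → PTerm
  (t ⊓ s) v = ∃ λ x → ∃ λ y → t x × s y × IsInf x y v

  _⊔ₚ_ : PTerm → PTerm → PTerm
  (t ⊔ₚ s) v = ∃ λ x → ∃ λ y → t x × s y × (x ∨ y ≡ v)

  -- Convention for equations involving ∧: if either side exists then
  -- the other also exists and they are equal.
  _≐_ : PTerm → PTerm → Set a
  t ≐ s = (∀ v → t v → s v) × (∀ v → s v → t v)

  IsSubsemilattice : {ℓ : Level} → Pred Carrier ℓ → Set (a ⊔ ℓ)
  IsSubsemilattice I = ∀ x y → I x → I y → I (x ∨ y)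

  IsGreatest : Carrier → Set a
  IsGreatest t = ∀ x → x ≤ t

  UpwardClosed : {ℓ : Level} → Pred Carrier ℓ → Set (a ⊔ ℓ)
  UpwardClosed I = ∀ x y → I x → x ≤ y → I y

  φ : Carrier → Carrier → Carrier → Carrier → Set a
  φ c x₁ x₂ x =
      (⌜ x ⌝ ≐ (⌜ x ∨ x₁ ⌝ ⊓ ⌜ x ∨ x₂ ⌝))
    × (⌜ x₁ ⌝ ≐ (⌜ x ∨ x₁ ⌝ ⊓ ⌜ c ∨ x₁ ⌝))
    × (⌜ x₂ ⌝ ≐ (⌜ x ∨ x₂ ⌝ ⊓ ⌜ c ∨ x₂ ⌝))
    × (x₁ ∨ x₂ ≡ x ∨ c)

  module _ {ℓ : Level} (c : Carrier) (I₁ I₂ : Pred Carrier ℓ) where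

    Mod1 : Set (a ⊔ ℓ)
    Mod1 = ∀ x y x₁ x₂ → I₁ x₁ → I₂ x₂ → (x₁ ∨ x₂) ≤ (x ∨ c) →
      ((⌜ x ∨ x₁ ⌝ ⊓ ⌜ x ∨ x₂ ⌝) ⊔ₚ ⌜ y ⌝) ≐ (⌜ x ∨ y ∨ x₁ ⌝ ⊓ ⌜ x ∨ y ∨ x₂ ⌝)

    Mod2 : Set (a ⊔ ℓ)
    Mod2 = ∀ x y x₁ x₂ → I₁ x₁ → I₂ x₂ → x ≤ (x₁ ∨ x₂) →
        (((⌜ x ∨ x₁ ⌝ ⊓ ⌜ c ∨ x₁ ⌝) ⊔ₚ ⌜ y ⌝) ≐ (⌜ x ∨ y ∨ x₁ ⌝ ⊓ ⌜ c ∨ y ∨ x₁ ⌝))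
      × (((⌜ x ∨ x₂ ⌝ ⊓ ⌜ c ∨ x₂ ⌝) ⊔ₚ ⌜ y ⌝) ≐ (⌜ x ∨ y ∨ x₂ ⌝ ⊓ ⌜ c ∨ y ∨ x₂ ⌝))

    Abs : Set (a ⊔ ℓ)
    Abs = (∀ x₁ y₁ z₂ → I₁ x₁ → I₁ y₁ → I₂ z₂ →
             (⌜ x₁ ⌝ ⊓ ⌜ y₁ ∨ z₂ ⌝) ≐ (⌜ x₁ ⌝ ⊓ ⌜ y₁ ∨ c ⌝))
        × (∀ x₂ y₂ z₁ → I₂ x₂ → I₂ y₂ → I₁ z₁ →
             (⌜ x₂ ⌝ ⊓ ⌜ y₂ ∨ z₁ ⌝) ≐ (⌜ x₂ ⌝ ⊓ ⌜ y₂ ∨ c ⌝))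

    Exi : Set (a ⊔ ℓ)
    Exi = ∀ x₁ x₂ → I₁ x₁ → I₂ x₂ → ∃ λ x → φ c x₁ x₂ x

    Onto : Set (a ⊔ ℓ)
    Onto = ∀ x → ∃ λ x₁ → ∃ λ x₂ → I₁ x₁ × I₂ x₂ × φ c x₁ x₂ x

    DirectSum : Set (a ⊔ ℓ)
    DirectSum = Mod1 × Mod2 × Abs × Exi × Onto

  module _ {ℓ : Level} (I₁ I₂ : Pred Carrier ℓ) where

    Exi' : Carrier → Set (a ⊔ ℓ)
    Exi' one = ∀ x₁ x₂ → I₁ x₁ → I₂ x₂ → x₁ ∨ x₂ ≡ one

    Onto' : Set (a ⊔ ℓ)
    Onto' = (∀ x₁ x₂ → I₁ x₁ → I₂ x₂ → ∃ λ m → IsInf x₁ x₂ m)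
          × (∀ x → ∃ λ x₁ → ∃ λ x₂ → I₁ x₁ × I₂ x₂ × IsInf x₁ x₂ x)

    Mod1' : Set (a ⊔ ℓ)
    Mod1' = ∀ x₁ x₂ y → I₁ x₁ → I₂ x₂ →
      ((⌜ x₁ ⌝ ⊓ ⌜ x₂ ⌝) ⊔ₚ ⌜ y ⌝) ≐ (⌜ y ∨ x₁ ⌝ ⊓ ⌜ y ∨ x₂ ⌝)

-- With a top element 1, φ₁(x₁, x₂, x) says exactly that x₁ ∨ x₂ = 1 and x = x₁ ∧ x₂,
-- because joining with 1 trivialises the projection conditions (p1), (p2); for the same
-- reason (Mod2) always holds, and (Abs) follows from (exi'). So (exi), (onto) become
-- (exi'), (onto'), and (Mod1) is (Mod1') read at x = x₁ ∧ x₂. Conversely, (exi') and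
-- (onto') already make I₁, I₂ upward closed: if x₁ ≤ y = y₁ ∧ y₂ then x₁ ≤ y₂, so
-- y₂ = x₁ ∨ y₂ = 1 and y = y₁. Hence x ∨ x₁ ∈ I₁, x ∨ x₂ ∈ I₂, and (Mod1') at these
-- elements gives (Mod1).
module Submission where

import Defs
open Defs using (JoinSemilattice)
open import Level using (Level)
open import Data.Product using (_×_; _,_; proj₁; proj₂; ∃)
open import Relation.Unary using (Pred)
open import Relation.Binary.Bundles using (Setoid)
open import Relation.Binary.Structures using (IsEquivalence)
open import Relation.Binary.PropositionalEquality
open import Function.Bundles using (_⇔_; mk⇔)
open import Algebra.Bundles using (CommutativeSemigroup)
open import Algebra.Structures using (module IsCommutativeBand)
import Algebra.Properties.CommutativeSemigroup as CommutativeSemigroupProperties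
import Relation.Binary.Reasoning.Setoid as SetoidReasoning

module JoinSemilatticeProperties {a : Level} (L : JoinSemilattice a) where

  open JoinSemilattice L public

  infix 4 _≤_ _≐_
  infixl 7 _⊓_
  infixl 6 _⊔ₚ_

  _≤_ : Carrier → Carrier → Set a
  _≤_ = Defs._≤_ L

  IsInf : Carrier → Carrier → Carrier → Set a
  IsInf = Defs.IsInf L

  PTerm : Set (Level.suc a)
  PTerm = Defs.PTerm L

  ⌜_⌝ : Carrier → PTerm
  ⌜_⌝ = Defs.⌜_⌝ L

  _⊓_ _⊔ₚ_ : PTerm → PTerm → PTerm
  _⊓_ = Defs._⊓_ L
  _⊔ₚ_ = Defs._⊔ₚ_ L

  _≐_ : PTerm → PTerm → Set a
  _≐_ = Defs._≐_ L

  ∨-commutativeSemigroup : CommutativeSemigroup a a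
  ∨-commutativeSemigroup = record
    { isCommutativeSemigroup = IsCommutativeBand.isCommutativeSemigroup isSemilattice }

  open CommutativeSemigroup ∨-commutativeSemigroup public using (assoc; comm)
  open CommutativeSemigroupProperties ∨-commutativeSemigroup public
    using (x∙yz≈y∙xz; x∙yz≈yx∙z; xy∙z≈xz∙y; xy∙z≈y∙xz)

  idem : ∀ x → x ∨ x ≡ x
  idem = IsCommutativeBand.idem isSemilattice

  ≤-refl : ∀ {x} → x ≤ x
  ≤-refl = idem _

  ≤-trans : ∀ {x y z} → x ≤ y → y ≤ z → x ≤ z
  ≤-trans {x} {y} {z} x≤y y≤z = begin
    x ∨ z        ≡⟨ cong (x ∨_) y≤z ⟨
    x ∨ (y ∨ z)  ≡⟨ assoc x y z ⟨
    x ∨ y ∨ z    ≡⟨ cong (_∨ z) x≤y ⟩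
    y ∨ z        ≡⟨ y≤z ⟩
    z            ∎
    where open ≡-Reasoning

  y≤x∨y : ∀ x y → y ≤ x ∨ y
  y≤x∨y x y = trans (x∙yz≈y∙xz y x y) (cong (x ∨_) (idem y))

  ≤⇒∨-absorbˡ : ∀ {x z} y → x ≤ z → x ∨ y ∨ z ≡ y ∨ z
  ≤⇒∨-absorbˡ {x} {z} y x≤z = trans (xy∙z≈y∙xz x y z) (cong (y ∨_) x≤z)

  IsInf-unique : ∀ {x y m m′} → IsInf x y m → IsInf x y m′ → m ≡ m′
  IsInf-unique (m≤x , m≤y , m-greatest) (m′≤x , m′≤y , m′-greatest) =
    trans (sym (m-greatest _ m′≤x m′≤y)) (trans (comm _ _) (m′-greatest _ m≤x m≤y))

  IsInf-comm : ∀ {x y m} → IsInf x y m → IsInf y x m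
  IsInf-comm (m≤x , m≤y , m-greatest) = m≤y , m≤x , λ z z≤y z≤x → m-greatest z z≤x z≤y

  IsInf-≤ : ∀ {x y} → x ≤ y → IsInf x y x
  IsInf-≤ x≤y = ≤-refl , x≤y , λ _ z≤x _ → z≤x

  ≐-isEquivalence : IsEquivalence _≐_
  ≐-isEquivalence = record
    { refl  = (λ _ t → t) , (λ _ t → t)
    ; sym   = λ (f , g) → g , f
    ; trans = λ (f , g) (h , k) → (λ v t → h v (f v t)) , (λ v t → g v (k v t))
    }

  ≐-setoid : Setoid (Level.suc a) a
  ≐-setoid = record { isEquivalence = ≐-isEquivalence }

  open IsEquivalence ≐-isEquivalence public
    using () renaming (refl to ≐-refl; sym to ≐-sym; trans to ≐-trans)

  ⌜⌝-cong : ∀ {x y} → x ≡ y → ⌜ x ⌝ ≐ ⌜ y ⌝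
  ⌜⌝-cong refl = ≐-refl

  ⌜⌝-injective : ∀ {x y} → ⌜ x ⌝ ≐ ⌜ y ⌝ → x ≡ y
  ⌜⌝-injective (f , _) = sym (f _ refl)

  ⊓-cong : ∀ {t t′ s s′} → t ≐ t′ → s ≐ s′ → t ⊓ s ≐ t′ ⊓ s′
  ⊓-cong (f , f⁻) (g , g⁻) =
      (λ { v (x , y , tx , sy , inf) → x , y , f x tx , g y sy , inf })
    , (λ { v (x , y , tx , sy , inf) → x , y , f⁻ x tx , g⁻ y sy , inf })

  ⊔ₚ-congˡ : ∀ {t t′ s} → t ≐ t′ → t ⊔ₚ s ≐ t′ ⊔ₚ s
  ⊔ₚ-congˡ (f , f⁻) =
      (λ { v (x , y , tx , sy , eq) → x , y , f x tx , sy , eq })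
    , (λ { v (x , y , tx , sy , eq) → x , y , f⁻ x tx , sy , eq })

  ⌜⌝⊔ₚ⌜⌝ : ∀ x y → ⌜ x ⌝ ⊔ₚ ⌜ y ⌝ ≐ ⌜ x ∨ y ⌝
  ⌜⌝⊔ₚ⌜⌝ x y = (λ { v (_ , _ , refl , refl , eq) → eq })
              , (λ { v refl → x , y , refl , refl , refl })

  IsInf⇒⌜⌝≐⊓ : ∀ {x y m} → IsInf x y m → ⌜ m ⌝ ≐ ⌜ x ⌝ ⊓ ⌜ y ⌝
  IsInf⇒⌜⌝≐⊓ inf = (λ { v refl → _ , _ , refl , refl , inf })
                  , (λ { v (_ , _ , refl , refl , inf′) → IsInf-unique inf inf′ })

  ⌜⌝≐⊓⇒IsInf : ∀ {x y m} → ⌜ m ⌝ ≐ ⌜ x ⌝ ⊓ ⌜ y ⌝ → IsInf x y m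
  ⌜⌝≐⊓⇒IsInf (f , _) with f _ refl
  ... | _ , _ , refl , refl , inf = inf

module TopElementProperties {a : Level} (L : JoinSemilattice a)
  (one : JoinSemilattice.Carrier L) (top : Defs.IsGreatest L one) where

  open JoinSemilatticeProperties L
  open Defs using (φ; Mod2)

  ∨-zeroˡ : ∀ x → one ∨ x ≡ one
  ∨-zeroˡ x = trans (comm one x) (top x)

  IsInf-identityʳ : ∀ {x m} → IsInf x one m → m ≡ x
  IsInf-identityʳ inf = IsInf-unique inf (IsInf-≤ (top _))

  ⊓-identityʳ : ∀ x {t} → t ≡ one → ⌜ x ⌝ ⊓ ⌜ t ⌝ ≐ ⌜ x ⌝
  ⊓-identityʳ x refl = ≐-sym (IsInf⇒⌜⌝≐⊓ (IsInf-≤ (top x)))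

  φ₁-intro : ∀ {x₁ x₂ x} → x₁ ∨ x₂ ≡ one → IsInf x₁ x₂ x → φ L one x₁ x₂ x
  φ₁-intro {x₁} {x₂} {x} x₁∨x₂≡one inf@(x≤x₁ , x≤x₂ , _) =
    dist , projection x≤x₁ , projection x≤x₂ , trans x₁∨x₂≡one (sym (top x))
    where
    dist : ⌜ x ⌝ ≐ ⌜ x ∨ x₁ ⌝ ⊓ ⌜ x ∨ x₂ ⌝
    dist = ≐-trans (IsInf⇒⌜⌝≐⊓ inf) (⊓-cong (⌜⌝-cong (sym x≤x₁)) (⌜⌝-cong (sym x≤x₂)))

    projection : ∀ {z} → x ≤ z → ⌜ z ⌝ ≐ ⌜ x ∨ z ⌝ ⊓ ⌜ one ∨ z ⌝
    projection {z} x≤z = ≐-sym (≐-trans (⊓-identityʳ (x ∨ z) (∨-zeroˡ z)) (⌜⌝-cong x≤z))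

  φ₁-elim : ∀ {x₁ x₂ x} → φ L one x₁ x₂ x → x₁ ∨ x₂ ≡ one × IsInf x₁ x₂ x
  φ₁-elim {x₁} {x₂} {x} (dist , p₁ , p₂ , x₁∨x₂≡x∨one) =
    trans x₁∨x₂≡x∨one (top x) ,
    ⌜⌝≐⊓⇒IsInf (≐-trans dist (⊓-cong (⌜⌝-cong (≤-of p₁)) (⌜⌝-cong (≤-of p₂))))
    where
    ≤-of : ∀ {z} → ⌜ z ⌝ ≐ ⌜ x ∨ z ⌝ ⊓ ⌜ one ∨ z ⌝ → x ≤ z
    ≤-of {z} p = sym (⌜⌝-injective (≐-trans p (⊓-identityʳ (x ∨ z) (∨-zeroˡ z))))

  Mod2-top : ∀ {ℓ} (I₁ I₂ : Pred Carrier ℓ) → Mod2 L one I₁ I₂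
  Mod2-top _ _ x y x₁ x₂ _ _ _ = modular x₁ , modular x₂
    where
    open SetoidReasoning ≐-setoid

    modular : ∀ z → (⌜ x ∨ z ⌝ ⊓ ⌜ one ∨ z ⌝) ⊔ₚ ⌜ y ⌝ ≐ ⌜ x ∨ y ∨ z ⌝ ⊓ ⌜ one ∨ y ∨ z ⌝
    modular z = begin
      (⌜ x ∨ z ⌝ ⊓ ⌜ one ∨ z ⌝) ⊔ₚ ⌜ y ⌝  ≈⟨ ⊔ₚ-congˡ (⊓-identityʳ (x ∨ z) (∨-zeroˡ z)) ⟩
      ⌜ x ∨ z ⌝ ⊔ₚ ⌜ y ⌝                   ≈⟨ ⌜⌝⊔ₚ⌜⌝ (x ∨ z) y ⟩
      ⌜ x ∨ z ∨ y ⌝                        ≈⟨ ⌜⌝-cong (xy∙z≈xz∙y x y z) ⟨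
      ⌜ x ∨ y ∨ z ⌝                        ≈⟨ ⊓-identityʳ (x ∨ y ∨ z) one∨y∨z≡one ⟨
      ⌜ x ∨ y ∨ z ⌝ ⊓ ⌜ one ∨ y ∨ z ⌝      ∎
      where
      one∨y∨z≡one : one ∨ y ∨ z ≡ one
      one∨y∨z≡one = trans (cong (_∨ z) (∨-zeroˡ y)) (∨-zeroˡ z)

module DirectSumAtTop {a ℓ : Level} (L : JoinSemilattice a)
  (one : JoinSemilattice.Carrier L) (top : Defs.IsGreatest L one)
  (I₁ I₂ : Pred (JoinSemilattice.Carrier L) ℓ) where

  open JoinSemilatticeProperties L
  open TopElementProperties L one top
  open Defs using (Mod1; Abs; Exi; Onto; DirectSum; Exi'; Onto'; Mod1'; UpwardClosed)

  IsInf-collapse : ∀ {x y y₁ y₂} → IsInf y₁ y₂ y → x ≤ y → x ∨ y₂ ≡ one → y ≡ y₁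
  IsInf-collapse {x} {y} {y₁} {y₂} inf@(_ , y≤y₂ , _) x≤y x∨y₂≡one =
    IsInf-identityʳ (subst (λ q → IsInf y₁ q y) y₂≡one inf)
    where
    y₂≡one : y₂ ≡ one
    y₂≡one = trans (sym (≤-trans x≤y y≤y₂)) x∨y₂≡one

  module _ (exi' : Exi' L I₁ I₂ one) (onto' : Onto' L I₁ I₂) where

    upwardClosed₁ : UpwardClosed L I₁
    upwardClosed₁ x y x∈I₁ x≤y with proj₂ onto' y
    ... | y₁ , y₂ , y₁∈I₁ , y₂∈I₂ , inf =
      subst I₁ (sym (IsInf-collapse inf x≤y (exi' x y₂ x∈I₁ y₂∈I₂))) y₁∈I₁

    upwardClosed₂ : UpwardClosed L I₂
    upwardClosed₂ x y x∈I₂ x≤y with proj₂ onto' y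
    ... | y₁ , y₂ , y₁∈I₁ , y₂∈I₂ , inf =
      subst I₂ (sym (IsInf-collapse (IsInf-comm inf) x≤y
                      (trans (comm x y₁) (exi' y₁ x y₁∈I₁ x∈I₂)))) y₂∈I₂

  Abs-top : Exi' L I₁ I₂ one → Abs L one I₁ I₂
  Abs-top exi' =
      (λ _ y₁ z₂ _ y₁∈I₁ z₂∈I₂ → ⊓-cong ≐-refl (⌜⌝-cong (join≡join-one (exi' y₁ z₂ y₁∈I₁ z₂∈I₂))))
    , (λ _ y₂ z₁ _ y₂∈I₂ z₁∈I₁ →
         ⊓-cong ≐-refl (⌜⌝-cong (join≡join-one (trans (comm y₂ z₁) (exi' z₁ y₂ z₁∈I₁ y₂∈I₂)))))
    where
    join≡join-one : ∀ {y z} → y ∨ z ≡ one → y ∨ z ≡ y ∨ one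
    join≡join-one {y} y∨z≡one = trans y∨z≡one (sym (top y))

  fromDirectSum : DirectSum L one I₁ I₂ → Exi' L I₁ I₂ one × Onto' L I₁ I₂ × Mod1' L I₁ I₂
  fromDirectSum (mod1 , _ , _ , exi , onto) = exi' , (meet , decompose) , mod1'
    where
    exi' : Exi' L I₁ I₂ one
    exi' x₁ x₂ x₁∈I₁ x₂∈I₂ = proj₁ (φ₁-elim (proj₂ (exi x₁ x₂ x₁∈I₁ x₂∈I₂)))

    meet : ∀ x₁ x₂ → I₁ x₁ → I₂ x₂ → ∃ λ m → IsInf x₁ x₂ m
    meet x₁ x₂ x₁∈I₁ x₂∈I₂ with exi x₁ x₂ x₁∈I₁ x₂∈I₂
    ... | m , φm = m , proj₂ (φ₁-elim φm)

    decompose : ∀ x → ∃ λ x₁ → ∃ λ x₂ → I₁ x₁ × I₂ x₂ × IsInf x₁ x₂ x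
    decompose x with onto x
    ... | x₁ , x₂ , x₁∈I₁ , x₂∈I₂ , φx = x₁ , x₂ , x₁∈I₁ , x₂∈I₂ , proj₂ (φ₁-elim φx)

    mod1' : Mod1' L I₁ I₂
    mod1' x₁ x₂ y x₁∈I₁ x₂∈I₂ with meet x₁ x₂ x₁∈I₁ x₂∈I₂
    ... | m , (m≤x₁ , m≤x₂ , _) = begin
      (⌜ x₁ ⌝ ⊓ ⌜ x₂ ⌝) ⊔ₚ ⌜ y ⌝              ≈⟨ ⊔ₚ-congˡ (⊓-cong (⌜⌝-cong m≤x₁) (⌜⌝-cong m≤x₂)) ⟨
      (⌜ m ∨ x₁ ⌝ ⊓ ⌜ m ∨ x₂ ⌝) ⊔ₚ ⌜ y ⌝      ≈⟨ mod1 m y x₁ x₂ x₁∈I₁ x₂∈I₂ x₁∨x₂≤m∨one ⟩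
      ⌜ m ∨ y ∨ x₁ ⌝ ⊓ ⌜ m ∨ y ∨ x₂ ⌝         ≈⟨ ⊓-cong (⌜⌝-cong (≤⇒∨-absorbˡ y m≤x₁))
                                                      (⌜⌝-cong (≤⇒∨-absorbˡ y m≤x₂)) ⟩
      ⌜ y ∨ x₁ ⌝ ⊓ ⌜ y ∨ x₂ ⌝                 ∎
      where
      open SetoidReasoning ≐-setoid
      x₁∨x₂≤m∨one : x₁ ∨ x₂ ≤ m ∨ one
      x₁∨x₂≤m∨one = subst (x₁ ∨ x₂ ≤_) (sym (top m)) (top (x₁ ∨ x₂))

  toDirectSum : Exi' L I₁ I₂ one × Onto' L I₁ I₂ × Mod1' L I₁ I₂ → DirectSum L one I₁ I₂
  toDirectSum (exi' , onto'@(meet , decompose) , mod1') =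
    mod1 , Mod2-top I₁ I₂ , Abs-top exi' , exi , onto
    where
    mod1 : Mod1 L one I₁ I₂
    mod1 x y x₁ x₂ x₁∈I₁ x₂∈I₂ _ =
      ≐-trans (mod1' (x ∨ x₁) (x ∨ x₂) y (upwardClosed₁ exi' onto' x₁ _ x₁∈I₁ (y≤x∨y x x₁))
                                          (upwardClosed₂ exi' onto' x₂ _ x₂∈I₂ (y≤x∨y x x₂)))
              (⊓-cong (⌜⌝-cong (x∙yz≈yx∙z y x x₁)) (⌜⌝-cong (x∙yz≈yx∙z y x x₂)))

    exi : Exi L one I₁ I₂
    exi x₁ x₂ x₁∈I₁ x₂∈I₂ with meet x₁ x₂ x₁∈I₁ x₂∈I₂
    ... | m , inf = m , φ₁-intro (exi' x₁ x₂ x₁∈I₁ x₂∈I₂) inf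

    onto : Onto L one I₁ I₂
    onto x with decompose x
    ... | x₁ , x₂ , x₁∈I₁ , x₂∈I₂ , inf =
      x₁ , x₂ , x₁∈I₁ , x₂∈I₂ , φ₁-intro (exi' x₁ x₂ x₁∈I₁ x₂∈I₂) inf

open Defs

theorem3 : {a ℓ : Level} (L : JoinSemilattice a) →
    (one : JoinSemilattice.Carrier L) → IsGreatest L one →
    (I₁ I₂ : Pred (JoinSemilattice.Carrier L) ℓ) →
    IsSubsemilattice L I₁ → IsSubsemilattice L I₂ →
      (DirectSum L one I₁ I₂ ⇔ (Exi' L I₁ I₂ one × Onto' L I₁ I₂ × Mod1' L I₁ I₂))
    × (DirectSum L one I₁ I₂ → UpwardClosed L I₁ × UpwardClosed L I₂)
theorem3 L one top I₁ I₂ _ _ =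
    mk⇔ fromDirectSum toDirectSum
  , λ sum → let (exi' , onto' , _) = fromDirectSum sum in
      upwardClosed₁ exi' onto' , upwardClosed₂ exi' onto'
  where open DirectSumAtTop L one top I₁ I₂
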